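{- Let $k$ be a positive integer, $a=3k+2$, $S=\{a,a+1,a+2\}$, $G=\langle S\rangle$, $t=\lfloor 3k/2\rfloor$, and for $i\in[0,t+1]$ let $I_{i,k}=[ia,ia+2i]$. Let $H_{7,k}=\bigcup_{i=0}^{t}I_{i,k}\cup[(t+1)a,\infty[$. Then $G=H_{7,k}$ and $H_{7,k}$ is a $3$-permutation numerical semigroup.
   Context: For $a\le b$ in $\mathbb{N}$, $[a,b]=\{x\in\mathbb{N}: a\le x\le b\}$ and $[a,\infty[\,=\{x\in\mathbb{N}:x\ge a\}$. A numerical semigroup is a submonoid $G$ of $(\mathbb{N},+,0)$ with $\mathbb{N}\setminus G$ finite; $\langle S\rangle$ is the submonoid generated by $S$. Write the elements of $G$ as $0=g_0<g_1<g_2<\cdots$. For $n\ge 1$, $G$ is an $n$-permutation numerical semigroup if $G=\langle g_1,\dots,g_n\rangle$ and for every integer $k\ge 0$ the tuple $(g_{kn+1}\bmod n,\dots,g_{kn+n}\bmod n)$ contains exactly one representative of each residue class of $\mathbb{Z}/n\mathbb{Z}$. -}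

module Defs where

open import Data.Nat using (ℕ; zero; suc; _+_; _*_; _≤_; _<_; NonZero)
open import Data.Nat.DivMod using (_%_; _/_)
open import Data.Fin using (Fin; toℕ)
open import Data.Product using (Σ; ∃; ∃-syntax; _×_; _,_; ∃!)
open import Data.Sum using (_⊎_)
open import Relation.Nullary using (¬_)
open import Relation.Binary.PropositionalEquality using (_≡_)

Subset : Set₁
Subset = ℕ → Set

_≐_ : Subset → Subset → Set
A ≐ B = ∀ x → (A x → B x) × (B x → A x)

data ⟨_⟩ (S : Subset) : Subset where
  gen-zero : ⟨ S ⟩ 0
  gen-add  : ∀ {s y} → S s → ⟨ S ⟩ y → ⟨ S ⟩ (s + y)

record IsNumericalSemigroup (G : Subset) : Set where
  field
    has-zero  : G 0
    closed-+  : ∀ {x y} → G x → G y → G (x + y)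
    cofinite  : ∃[ N ] (∀ x → N ≤ x → G x)

-- Nth G i x : x is g_i, the i-th element of G in increasing order (g_0 the least).
data Nth (G : Subset) : ℕ → ℕ → Set where
  nth-zero : ∀ {x} → G x → (∀ y → y < x → ¬ G y) → Nth G 0 x
  nth-suc  : ∀ {i w x} → Nth G i w → w < x → G x →
             (∀ y → w < y → y < x → ¬ G y) → Nth G (suc i) x

IsPermNumericalSemigroup : (n : ℕ) → .{{_ : NonZero n}} → Subset → Set
IsPermNumericalSemigroup n G =
  IsNumericalSemigroup G ×
  (Σ (ℕ → ℕ) λ g →
     (∀ i → Nth G i (g i)) ×
     (G ≐ ⟨ (λ x → ∃[ j ] ((1 ≤ j) × (j ≤ n) × (x ≡ g j))) ⟩) ×
     (∀ k (r : Fin n) → ∃! _≡_ (λ (j : Fin n) → g (k * n + suc (toℕ j)) % n ≡ toℕ r)))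

aₖ : ℕ → ℕ
aₖ k = 3 * k + 2

Sₖ : ℕ → Subset
Sₖ k x = (x ≡ aₖ k) ⊎ (x ≡ aₖ k + 1) ⊎ (x ≡ aₖ k + 2)

tₖ : ℕ → ℕ
tₖ k = (3 * k) / 2

I : ℕ → ℕ → Subset
I i k x = (i * aₖ k ≤ x) × (x ≤ i * aₖ k + 2 * i)

H₇ : ℕ → Subset
H₇ k x = (∃[ i ] ((i ≤ tₖ k) × I i k x)) ⊎ (suc (tₖ k) * aₖ k ≤ x)

-- Sums of i elements of {a, a+1, a+2} fill exactly the interval [i a, i a + 2 i], so
-- ⟨a, a+1, a+2⟩ is the union of these intervals. Because 2 t < a the intervals with i ≤ t
-- are separated by gaps, and because a ≤ 2 (t+1) + 1 those with i > t cover [(t+1) a, ∞[.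
-- Enumerating interval by interval, the i-th interval starts at index i², and consecutive
-- elements differ by 1 except across a gap, where they differ by a − 2 i. A gap inside an
-- index block {3m+1, 3m+2, 3m+3} means 3 ∤ i² + 2 i, i.e. i ≡ 2 (mod 3), and then
-- a − 2 i ≡ 1 (mod 3) as a ≡ 2. So each block carries three consecutive residues.

module Submission where

open import Defs
open import Data.Nat using (ℕ; zero; suc; _+_; _*_; _∸_; _≤_; _<_; z≤n; s≤s; NonZero; >-nonZero; s≤s⁻¹)
open import Data.Nat.Properties
open import Data.Nat.DivMod
open import Data.Nat.Divisibility
open import Data.Nat.Tactic.RingSolver using (solve-∀)
open import Data.Fin using (Fin; toℕ; fromℕ<)
open import Data.Fin.Properties using (toℕ<n; toℕ-fromℕ<; toℕ-injective)
open import Data.Product using (∃-syntax; ∃!; _×_; _,_; proj₁; proj₂)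
open import Data.Sum using (_⊎_; inj₁; inj₂)
open import Function using (_∘_)
open import Relation.Nullary using (¬_; yes; no; contradiction)
open import Relation.Binary.PropositionalEquality

⟨⟩-map : ∀ {A B : Subset} → (∀ {x} → A x → B x) → ∀ {x} → ⟨ A ⟩ x → ⟨ B ⟩ x
⟨⟩-map f gen-zero        = gen-zero
⟨⟩-map f (gen-add s gy) = gen-add (f s) (⟨⟩-map f gy)

⟨⟩-+ : ∀ {A : Subset} {x y} → ⟨ A ⟩ x → ⟨ A ⟩ y → ⟨ A ⟩ (x + y)
⟨⟩-+ gen-zero gy = gy
⟨⟩-+ {A} {y = y} (gen-add {s} {x} sA gx) gy =
  subst ⟨ A ⟩ (sym (+-assoc s x y)) (gen-add sA (⟨⟩-+ gx gy))

module _ {n : ℕ} .{{_ : NonZero n}} where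
  open ≡-Reasoning

  +-congˡ-% : ∀ m {x y} → x % n ≡ y % n → (m + x) % n ≡ (m + y) % n
  +-congˡ-% m {x} {y} x≡y = begin
    (m + x) % n           ≡⟨ %-distribˡ-+ m x n ⟩
    (m % n + x % n) % n   ≡⟨ cong (λ z → (m % n + z) % n) x≡y ⟩
    (m % n + y % n) % n   ≡⟨ %-distribˡ-+ m y n ⟨
    (m + y) % n           ∎

  +-congʳ-% : ∀ m {x y} → x % n ≡ y % n → (x + m) % n ≡ (y + m) % n
  +-congʳ-% m {x} {y} x≡y = begin
    (x + m) % n  ≡⟨ cong (_% n) (+-comm x m) ⟩
    (m + x) % n  ≡⟨ +-congˡ-% m x≡y ⟩
    (m + y) % n  ≡⟨ cong (_% n) (+-comm m y) ⟩
    (y + m) % n  ∎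

  [c+x+[n∸c%n]]%n≡x%n : ∀ c x → (c + x + (n ∸ c % n)) % n ≡ x % n
  [c+x+[n∸c%n]]%n≡x%n c x = begin
    (c + x + d) % n                 ≡⟨ cong (λ z → (z + x + d) % n) (m≡m%n+[m/n]*n c n) ⟩
    (c % n + q * n + x + d) % n     ≡⟨ cong (_% n) (regroup (c % n) (q * n) x d) ⟩
    (x + (c % n + d) + q * n) % n   ≡⟨ [m+kn]%n≡m%n (x + (c % n + d)) q n ⟩
    (x + (c % n + d)) % n           ≡⟨ cong (λ z → (x + z) % n) (m+[n∸m]≡n (m%n≤n c n)) ⟩
    (x + n) % n                     ≡⟨ [m+n]%n≡m%n x n ⟩
    x % n                           ∎
    where
    d q : ℕ
    d = n ∸ c % n
    q = c / n
    regroup : ∀ r s x d → r + s + x + d ≡ x + (r + d) + s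
    regroup = solve-∀

  consecutive-residues-unique : ∀ c (r : Fin n) →
    ∃! _≡_ λ (j : Fin n) → (c + toℕ j) % n ≡ toℕ r
  consecutive-residues-unique c r = j₀ , c+j₀≡r , λ {j} eq → toℕ-injective (sym (toℕ-j eq))
    where
    d : ℕ
    d = n ∸ c % n
    j₀ : Fin n
    j₀ = fromℕ< (m%n<n (toℕ r + d) n)

    c+j₀≡r : (c + toℕ j₀) % n ≡ toℕ r
    c+j₀≡r = begin
      (c + toℕ j₀) % n         ≡⟨ +-congˡ-% c (trans (cong (_% n) (toℕ-fromℕ< _))
                                                     (m%n%n≡m%n (toℕ r + d) n)) ⟩
      (c + (toℕ r + d)) % n    ≡⟨ cong (_% n) (+-assoc c (toℕ r) d) ⟨
      (c + toℕ r + d) % n      ≡⟨ [c+x+[n∸c%n]]%n≡x%n c (toℕ r) ⟩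
      toℕ r % n                ≡⟨ m<n⇒m%n≡m (toℕ<n r) ⟩
      toℕ r                    ∎

    toℕ-j : ∀ {j} → (c + toℕ j) % n ≡ toℕ r → toℕ j ≡ toℕ j₀
    toℕ-j {j} eq = begin
      toℕ j                       ≡⟨ m<n⇒m%n≡m (toℕ<n j) ⟨
      toℕ j % n                   ≡⟨ [c+x+[n∸c%n]]%n≡x%n c (toℕ j) ⟨
      (c + toℕ j + d) % n         ≡⟨ +-congʳ-% d (m%n%n≡m%n (c + toℕ j) n) ⟨
      ((c + toℕ j) % n + d) % n   ≡⟨ cong (λ z → (z + d) % n) eq ⟩
      (toℕ r + d) % n             ≡⟨ toℕ-fromℕ< _ ⟨
      toℕ j₀                      ∎

  module _ (f : ℕ → ℕ) (unit-step : ∀ i → suc i < n → f (suc i) % n ≡ suc (f i) % n) where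

    unit-steps⇒f[j]%n≡[f0+j]%n : ∀ j → j < n → f j % n ≡ (f 0 + j) % n
    unit-steps⇒f[j]%n≡[f0+j]%n zero    _   = cong (_% n) (sym (+-identityʳ (f 0)))
    unit-steps⇒f[j]%n≡[f0+j]%n (suc j) j<n = begin
      f (suc j) % n     ≡⟨ unit-step j j<n ⟩
      (1 + f j) % n     ≡⟨ +-congˡ-% 1 (unit-steps⇒f[j]%n≡[f0+j]%n j (<-trans (n<1+n j) j<n)) ⟩
      (1 + (f 0 + j)) % n ≡⟨ cong (_% n) (+-suc (f 0) j) ⟨
      (f 0 + suc j) % n ∎

    unit-steps⇒residues-unique : ∀ (r : Fin n) → ∃! _≡_ λ (j : Fin n) → f (toℕ j) % n ≡ toℕ r
    unit-steps⇒residues-unique r with consecutive-residues-unique (f 0) r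
    ... | j , hit , unique =
      j , trans (unit-steps⇒f[j]%n≡[f0+j]%n (toℕ j) (toℕ<n j)) hit ,
      λ {j′} eq → unique (trans (sym (unit-steps⇒f[j]%n≡[f0+j]%n (toℕ j′) (toℕ<n j′))) eq)

3∤n*n+2*n⇒3∣1+n : ∀ n → ¬ 3 ∣ n * n + 2 * n → 3 ∣ suc n
3∤n*n+2*n⇒3∣1+n 0 3∤0 = contradiction (divides 0 refl) 3∤0
3∤n*n+2*n⇒3∣1+n 1 3∤3 = contradiction (divides 1 refl) 3∤3
3∤n*n+2*n⇒3∣1+n 2 _   = divides 1 refl
3∤n*n+2*n⇒3∣1+n (suc (suc (suc n))) 3∤ =
  ∣m∣n⇒∣m+n ∣-refl (3∤n*n+2*n⇒3∣1+n n (3∤ ∘ shift))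
  where
  expand : ∀ n → n * n + 2 * n + (2 * n + 5) * 3 ≡ (3 + n) * (3 + n) + 2 * (3 + n)
  expand = solve-∀
  shift : 3 ∣ n * n + 2 * n → 3 ∣ (3 + n) * (3 + n) + 2 * (3 + n)
  shift 3∣ = subst (3 ∣_) (expand n) (∣m∣n⇒∣m+n 3∣ (n∣m*n (2 * n + 5)))

-- (i + 1)(a + 2) = (i a + 2 i + 1) + (a + 1), so both sides are divisible by 3.
[1+i]*a%3≡[1+i*a+2*i]%3 : ∀ a i → 3 ∣ a + 1 → 3 ∣ suc i → suc i * a % 3 ≡ suc (i * a + 2 * i) % 3
[1+i]*a%3≡[1+i*a+2*i]%3 a i 3∣a+1 3∣1+i =
  trans (n∣m⇒m%n≡0 _ 3 (∣m⇒∣m*n a 3∣1+i)) (sym (n∣m⇒m%n≡0 _ 3 3∣rhs))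
  where
  expand : ∀ a i → a + 1 + suc (i * a + 2 * i) ≡ suc i * (a + 2)
  expand = solve-∀
  3∣rhs : 3 ∣ suc (i * a + 2 * i)
  3∣rhs = ∣m+n∣m⇒∣n (subst (3 ∣_) (sym (expand a i)) (∣m⇒∣m*n (a + 2) 3∣1+i)) 3∣a+1

Consecutive₃ : ℕ → Subset
Consecutive₃ a x = x ≡ a ⊎ x ≡ a + 1 ⊎ x ≡ a + 2

-- H₇ k is definitionally IntervalUnion (aₖ k) (tₖ k), and Sₖ k is Consecutive₃ (aₖ k).
IntervalUnion : ℕ → ℕ → Subset
IntervalUnion a t x = (∃[ i ] (i ≤ t × i * a ≤ x × x ≤ i * a + 2 * i)) ⊎ suc t * a ≤ x

module _ {a : ℕ} where

  Consecutive₃⇒a+e : ∀ {s} → Consecutive₃ a s → ∃[ e ] (e ≤ 2 × s ≡ a + e)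
  Consecutive₃⇒a+e (inj₁ refl)        = 0 , z≤n , sym (+-identityʳ a)
  Consecutive₃⇒a+e (inj₂ (inj₁ refl)) = 1 , s≤s z≤n , refl
  Consecutive₃⇒a+e (inj₂ (inj₂ refl)) = 2 , s≤s (s≤s z≤n) , refl

  interval⊆⟨Consecutive₃⟩ : ∀ i j → j ≤ 2 * i → ⟨ Consecutive₃ a ⟩ (i * a + j)
  interval⊆⟨Consecutive₃⟩ zero    zero          _    = gen-zero
  interval⊆⟨Consecutive₃⟩ (suc i) zero          _    =
    subst ⟨ Consecutive₃ a ⟩ (sym (+-assoc a (i * a) 0))
      (gen-add (inj₁ refl) (interval⊆⟨Consecutive₃⟩ i 0 z≤n))
  interval⊆⟨Consecutive₃⟩ (suc i) (suc zero)    _    =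
    subst ⟨ Consecutive₃ a ⟩ (regroup a i)
      (gen-add (inj₂ (inj₁ refl)) (interval⊆⟨Consecutive₃⟩ i 0 z≤n))
    where
    regroup : ∀ a i → a + 1 + (i * a + 0) ≡ a + i * a + 1
    regroup = solve-∀
  interval⊆⟨Consecutive₃⟩ (suc i) (suc (suc j)) j≤2i =
    subst ⟨ Consecutive₃ a ⟩ (regroup a i j)
      (gen-add (inj₂ (inj₂ refl)) (interval⊆⟨Consecutive₃⟩ i j j≤2i′))
    where
    regroup : ∀ a i j → a + 2 + (i * a + j) ≡ a + i * a + (2 + j)
    regroup = solve-∀
    j≤2i′ : j ≤ 2 * i
    j≤2i′ = +-cancelˡ-≤ 2 j (2 * i) (subst (2 + j ≤_) (*-suc 2 i) j≤2i)

  interval-+a+e-lower : ∀ e {i x} → i * a ≤ x → suc i * a ≤ a + e + x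
  interval-+a+e-lower e {i} {x} lo =
    subst (suc i * a ≤_) (sym (+-assoc a e x)) (+-monoʳ-≤ a (≤-trans lo (m≤n+m x e)))

  interval-+a+e-upper : ∀ {e i x} → e ≤ 2 → x ≤ i * a + 2 * i → a + e + x ≤ suc i * a + 2 * suc i
  interval-+a+e-upper {i = i} e≤2 hi =
    ≤-trans (+-mono-≤ (+-monoʳ-≤ a e≤2) hi) (≤-reflexive (regroup a i))
    where
    regroup : ∀ a i → a + 2 + (i * a + 2 * i) ≡ a + i * a + 2 * suc i
    regroup = solve-∀

module _ (a t : ℕ) where

  private
    H : Subset
    H = IntervalUnion a t

  IntervalUnion-+a+e : ∀ e x → e ≤ 2 → H x → H (a + e + x)
  IntervalUnion-+a+e e x e≤2 (inj₂ tail) = inj₂ (≤-trans tail (m≤n+m x (a + e)))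
  IntervalUnion-+a+e e x e≤2 (inj₁ (i , i≤t , lo , hi)) with suc i ≤? t
  ... | yes 1+i≤t = inj₁ (suc i , 1+i≤t , interval-+a+e-lower e {i} lo , interval-+a+e-upper e≤2 hi)
  ... | no  1+i≰t = inj₂ (subst (λ m → suc m * a ≤ a + e + x) (≤-antisym i≤t (≮⇒≥ 1+i≰t))
                                (interval-+a+e-lower e {i} lo))

  ⟨Consecutive₃⟩⊆IntervalUnion : ∀ {x} → ⟨ Consecutive₃ a ⟩ x → H x
  ⟨Consecutive₃⟩⊆IntervalUnion gen-zero = inj₁ (0 , z≤n , z≤n , z≤n)
  ⟨Consecutive₃⟩⊆IntervalUnion (gen-add s∈ gy) with Consecutive₃⇒a+e s∈
  ... | e , e≤2 , refl = IntervalUnion-+a+e e _ e≤2 (⟨Consecutive₃⟩⊆IntervalUnion gy)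

  module _ (0<a : 0 < a) (a≤2t+3 : a ≤ 2 * t + 3) where

    private
      instance
        a≢0 : NonZero a
        a≢0 = >-nonZero 0<a

    -- Write x = (t+1+q) a + r with r < a; then r ≤ 2 (t+1+q) because a ≤ 2 (t+1) + 1.
    tail⊆⟨Consecutive₃⟩ : ∀ x → suc t * a ≤ x → ⟨ Consecutive₃ a ⟩ x
    tail⊆⟨Consecutive₃⟩ x tail≤x =
      subst ⟨ Consecutive₃ a ⟩ x≡ (interval⊆⟨Consecutive₃⟩ (suc t + q) r r≤)
      where
      d q r : ℕ
      d = x ∸ suc t * a
      q = d / a
      r = d % a
      r≤ : r ≤ 2 * (suc t + q)
      r≤ = ≤-trans (s≤s⁻¹ (≤-trans (m%n<n d a) (≤-trans a≤2t+3 (≤-reflexive (+-suc (2 * t) 2)))))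
                   (≤-trans (≤-reflexive (trans (+-comm (2 * t) 2) (sym (*-suc 2 t))))
                            (*-monoʳ-≤ 2 (m≤m+n (suc t) q)))
      regroup : ∀ t q a r → (suc t + q) * a + r ≡ suc t * a + (r + q * a)
      regroup = solve-∀
      x≡ : (suc t + q) * a + r ≡ x
      x≡ = trans (regroup t q a r)
             (trans (cong (suc t * a +_) (sym (m≡m%n+[m/n]*n d a))) (m+[n∸m]≡n tail≤x))

    IntervalUnion⊆⟨Consecutive₃⟩ : ∀ {x} → H x → ⟨ Consecutive₃ a ⟩ x
    IntervalUnion⊆⟨Consecutive₃⟩ (inj₂ tail≤x) = tail⊆⟨Consecutive₃⟩ _ tail≤x
    IntervalUnion⊆⟨Consecutive₃⟩ {x} (inj₁ (i , _ , lo , hi)) =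
      subst ⟨ Consecutive₃ a ⟩ (m+[n∸m]≡n lo) (interval⊆⟨Consecutive₃⟩ i (x ∸ i * a)
        (≤-trans (∸-monoˡ-≤ (i * a) hi) (≤-reflexive (m+n∸m≡n (i * a) (2 * i)))))

    ⟨Consecutive₃⟩≐IntervalUnion : ⟨ Consecutive₃ a ⟩ ≐ H
    ⟨Consecutive₃⟩≐IntervalUnion x = ⟨Consecutive₃⟩⊆IntervalUnion , IntervalUnion⊆⟨Consecutive₃⟩

    IntervalUnion-isNumericalSemigroup : IsNumericalSemigroup H
    IntervalUnion-isNumericalSemigroup = record
      { has-zero = inj₁ (0 , z≤n , z≤n , z≤n)
      ; closed-+ = λ x∈ y∈ → ⟨Consecutive₃⟩⊆IntervalUnion
                     (⟨⟩-+ (IntervalUnion⊆⟨Consecutive₃⟩ x∈) (IntervalUnion⊆⟨Consecutive₃⟩ y∈))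
      ; cofinite = suc t * a , λ _ → inj₂
      }

module Enumeration (a t : ℕ) (2t<a : 2 * t < a) where

  private
    H : Subset
    H = IntervalUnion a t

  2i<a : ∀ {i} → i ≤ t → 2 * i < a
  2i<a i≤t = ≤-<-trans (*-monoʳ-≤ 2 i≤t) 2t<a

  data Step (i j : ℕ) : Set where
    jump : i ≤ t → j ≡ 2 * i → Step i j
    walk : ¬ (i ≤ t × j ≡ 2 * i) → Step i j

  step : ∀ i j → Step i j
  step i j with j ≟ 2 * i | i ≤? t
  ... | yes j≡2i | yes i≤t = jump i≤t j≡2i
  ... | yes _    | no i≰t  = walk (i≰t ∘ proj₁)
  ... | no j≢2i  | _       = walk (j≢2i ∘ proj₂)

  after : ∀ {i j} → Step i j → ℕ × ℕ
  after {i}     (jump _ _) = suc i , 0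
  after {i} {j} (walk _)   = i , suc j

  next : ℕ × ℕ → ℕ × ℕ
  next (i , j) = after (step i j)

  -- coord p = (i , j) locates g_p = i a + j as the j-th element of the i-th interval,
  -- which is preceded by 1 + 3 + … + (2 i − 1) = i * i elements.
  coord : ℕ → ℕ × ℕ
  coord zero    = 0 , 0
  coord (suc p) = next (coord p)

  value : ℕ × ℕ → ℕ
  value (i , j) = i * a + j

  index : ℕ × ℕ → ℕ
  index (i , j) = i * i + j

  enum : ℕ → ℕ
  enum p = value (coord p)

  Reachable : ℕ × ℕ → Set
  Reachable (i , j) = (i ≤ t × j ≤ 2 * i) ⊎ i ≡ suc t

  next-reachable : ∀ c → Reachable c → Reachable (next c)
  next-reachable (i , j) r with step i j
  next-reachable (i , j) r                    | jump i≤t _ with suc i ≤? t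
  ... | yes 1+i≤t = inj₁ (1+i≤t , z≤n)
  ... | no  1+i≰t = inj₂ (cong suc (≤-antisym i≤t (≮⇒≥ 1+i≰t)))
  next-reachable (i , j) (inj₁ (i≤t , j≤2i)) | walk ¬jump = inj₁ (i≤t , ≤∧≢⇒< j≤2i (¬jump ∘ (i≤t ,_)))
  next-reachable (i , j) (inj₂ i≡1+t)        | walk _     = inj₂ i≡1+t

  coord-reachable : ∀ p → Reachable (coord p)
  coord-reachable zero    = inj₁ (z≤n , z≤n)
  coord-reachable (suc p) = next-reachable (coord p) (coord-reachable p)

  index-next : ∀ c → index (next c) ≡ suc (index c)
  index-next (i , j) with step i j
  ... | jump _ refl = square i
    where
    square : ∀ i → suc i * suc i + 0 ≡ suc (i * i + 2 * i)
    square = solve-∀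
  ... | walk _ = +-suc (i * i) j

  index-coord : ∀ p → index (coord p) ≡ p
  index-coord zero    = refl
  index-coord (suc p) = trans (index-next (coord p)) (cong suc (index-coord p))

  value∈H : ∀ c → Reachable c → H (value c)
  value∈H (i , j) (inj₁ (i≤t , j≤2i)) = inj₁ (i , i≤t , m≤m+n (i * a) j , +-monoʳ-≤ (i * a) j≤2i)
  value∈H (i , j) (inj₂ refl)          = inj₂ (m≤m+n (suc t * a) j)

  value-next> : ∀ c → value c < value (next c)
  value-next> (i , j) with step i j
  ... | jump i≤t refl = subst (i * a + 2 * i <_) (trans (+-comm (i * a) a) (sym (+-identityʳ _)))
                          (+-monoʳ-< (i * a) (2i<a i≤t))
  ... | walk _ = ≤-reflexive (sym (+-suc (i * a) j))

  ∉H-between-intervals : ∀ {i y} → i ≤ t → i * a + 2 * i < y → y < suc i * a → ¬ H y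
  ∉H-between-intervals i≤t lo hi (inj₂ tail≤y) = <⇒≱ hi (≤-trans (*-monoˡ-≤ a (s≤s i≤t)) tail≤y)
  ∉H-between-intervals {i} i≤t lo hi (inj₁ (i′ , _ , lo′ , hi′)) with i′ ≤? i
  ... | yes i′≤i = <⇒≱ lo (≤-trans hi′ (+-mono-≤ (*-monoˡ-≤ a i′≤i) (*-monoʳ-≤ 2 i′≤i)))
  ... | no  i′≰i = <⇒≱ hi (≤-trans (*-monoˡ-≤ a (≰⇒> i′≰i)) lo′)

  ∉H-before-next : ∀ c y → value c < y → y < value (next c) → ¬ H y
  ∉H-before-next (i , j) y lo hi with step i j
  ... | jump i≤t refl = ∉H-between-intervals i≤t lo (subst (y <_) (+-identityʳ _) hi)
  ... | walk _ = λ _ → <⇒≱ lo (s≤s⁻¹ (subst (y <_) (+-suc (i * a) j) hi))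

  Nth-enum : ∀ p → Nth H p (enum p)
  Nth-enum zero    = nth-zero (inj₁ (0 , z≤n , z≤n , z≤n)) (λ _ ())
  Nth-enum (suc p) = nth-suc (Nth-enum p) (value-next> (coord p))
                       (value∈H (coord (suc p)) (coord-reachable (suc p))) (∉H-before-next (coord p))

  enum-1 : enum 1 ≡ a
  enum-1 = trans (+-identityʳ (1 * a)) (*-identityˡ a)

  enum-2 : enum 2 ≡ a + 1
  enum-2 = cong (_+ 1) (*-identityˡ a)

  enum-3 : enum 3 ≡ a + 2
  enum-3 = cong (_+ 2) (*-identityˡ a)

  module _ (3∣a+1 : 3 ∣ a + 1) where

    value-next-% : ∀ c → ¬ 3 ∣ index c → value (next c) % 3 ≡ suc (value c) % 3
    value-next-% (i , j) 3∤ with step i j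
    ... | jump _ refl = trans (cong (_% 3) (+-identityʳ (suc i * a)))
                          ([1+i]*a%3≡[1+i*a+2*i]%3 a i 3∣a+1 (3∤n*n+2*n⇒3∣1+n i 3∤))
    ... | walk _      = cong (_% 3) (+-suc (i * a) j)

    enum-block-% : ∀ m i → suc i < 3 → enum (m * 3 + suc (suc i)) % 3 ≡ suc (enum (m * 3 + suc i)) % 3
    enum-block-% m i 1+i<3 = trans (cong (λ p → enum p % 3) (+-suc (m * 3) (suc i)))
                               (value-next-% (coord p) (3∤p ∘ subst (3 ∣_) (index-coord p)))
      where
      p : ℕ
      p = m * 3 + suc i
      3∤p : ¬ 3 ∣ p
      3∤p 3∣p = <⇒≱ 1+i<3 (∣⇒≤ (∣m+n∣m⇒∣n 3∣p (n∣m*n m)))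

  0<a : 0 < a
  0<a = ≤-<-trans z≤n 2t<a

  Generators : Subset
  Generators x = ∃[ j ] (1 ≤ j × j ≤ 3 × x ≡ enum j)

  Consecutive₃⇒Generators : ∀ {x} → Consecutive₃ a x → Generators x
  Consecutive₃⇒Generators (inj₁ refl)        = 1 , s≤s z≤n , s≤s z≤n , sym enum-1
  Consecutive₃⇒Generators (inj₂ (inj₁ refl)) = 2 , s≤s z≤n , s≤s (s≤s z≤n) , sym enum-2
  Consecutive₃⇒Generators (inj₂ (inj₂ refl)) = 3 , s≤s z≤n , s≤s (s≤s (s≤s z≤n)) , sym enum-3

  Generators⇒Consecutive₃ : ∀ {x} → Generators x → Consecutive₃ a x
  Generators⇒Consecutive₃ (1 , _ , _ , refl) = inj₁ enum-1
  Generators⇒Consecutive₃ (2 , _ , _ , refl) = inj₂ (inj₁ enum-2)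
  Generators⇒Consecutive₃ (3 , _ , _ , refl) = inj₂ (inj₂ enum-3)
  Generators⇒Consecutive₃ (suc (suc (suc (suc _))) , _ , s≤s (s≤s (s≤s ())) , _)

  IntervalUnion-3-permutation : 3 ∣ a + 1 → a ≤ 2 * t + 3 → IsPermNumericalSemigroup 3 H
  IntervalUnion-3-permutation 3∣a+1 a≤2t+3 =
    IntervalUnion-isNumericalSemigroup a t 0<a a≤2t+3 ,
    enum ,
    Nth-enum ,
    (λ x → ⟨⟩-map Consecutive₃⇒Generators ∘ IntervalUnion⊆⟨Consecutive₃⟩ a t 0<a a≤2t+3 ,
           ⟨Consecutive₃⟩⊆IntervalUnion a t ∘ ⟨⟩-map Generators⇒Consecutive₃) ,
    λ m → unit-steps⇒residues-unique (λ j → enum (m * 3 + suc j)) (enum-block-% 3∣a+1 m)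

open Enumeration using (IntervalUnion-3-permutation)

2*tₖ<aₖ : ∀ k → 2 * tₖ k < aₖ k
2*tₖ<aₖ k =
  ≤-<-trans (≤-trans (≤-reflexive (*-comm 2 (tₖ k))) (m/n*n≤m (3 * k) 2)) (m<m+n (3 * k) (s≤s z≤n))

aₖ≤2*tₖ+3 : ∀ k → aₖ k ≤ 2 * tₖ k + 3
aₖ≤2*tₖ+3 k = begin
  3 * k + 2                           ≡⟨ cong (_+ 2) (m≡m%n+[m/n]*n (3 * k) 2) ⟩
  (3 * k) % 2 + tₖ k * 2 + 2          ≤⟨ +-monoˡ-≤ 2 (+-monoˡ-≤ (tₖ k * 2) (s≤s⁻¹ (m%n<n (3 * k) 2))) ⟩
  1 + tₖ k * 2 + 2                    ≡⟨ regroup (tₖ k) ⟩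
  2 * tₖ k + 3                        ∎
  where
  open ≤-Reasoning
  regroup : ∀ t → 1 + t * 2 + 2 ≡ 2 * t + 3
  regroup = solve-∀

3∣aₖ+1 : ∀ k → 3 ∣ aₖ k + 1
3∣aₖ+1 k = divides (suc k) (expand k)
  where
  expand : ∀ k → 3 * k + 2 + 1 ≡ (1 + k) * 3
  expand = solve-∀

lemma4p7 : (k : ℕ) → 1 ≤ k →
    (⟨ Sₖ k ⟩ ≐ H₇ k) × IsPermNumericalSemigroup 3 (H₇ k)
lemma4p7 k _ =
  ⟨Consecutive₃⟩≐IntervalUnion (aₖ k) (tₖ k) (≤-<-trans z≤n (2*tₖ<aₖ k)) (aₖ≤2*tₖ+3 k) ,
  IntervalUnion-3-permutation (aₖ k) (tₖ k) (2*tₖ<aₖ k) (3∣aₖ+1 k) (aₖ≤2*tₖ+3 k)
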